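{- There exist a set $\Gamma$ of first-order sentences and a first-order sentence $\phi$ such that $\Gamma\mathrel{|\!\sim}\phi$ but there is no finite $\Gamma_0\subseteq\Gamma$ with $\Gamma_0\mathrel{|\!\sim}\phi$.
   Context: Work in first-order logic with equality (equality is a logical symbol always interpreted as true identity); function and constant symbols are regarded as predicate symbols, so vocabularies are relational. For a set $\Sigma$ of sentences, $L_\Sigma$ denotes the vocabulary of non-logical symbols occurring in $\Sigma$; $L_{\Gamma,\phi}=L_{\Gamma\cup\{\phi\}}$. For $K$-structures, $\mathfrak{A}\prec_K\mathfrak{B}$ means there is an elementary embedding of $\mathfrak{A}$ into $\mathfrak{B}$ with respect to $K$-formulas. Friendliness: $\Gamma \mathrel{|\!\sim}\phi$ iff for every $L_\Gamma$-structure $\mathfrak{A}\models\Gamma$ there is an $L_\Gamma$-structure $\mathfrak{A}'$ with $\mathfrak{A}\prec_{L_\Gamma}\mathfrak{A}'$ such that $\mathfrak{A}'$ has an expansion (same domain, same interpretation of $L_\Gamma$) to an $L_{\Gamma,\phi}$-structure $\mathfrak{A}''$ with $\mathfrak{A}''\models\phi$. -}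

module Defs where

open import Data.Nat using (ℕ; suc)
open import Data.Fin using (Fin; zero; suc)
open import Data.Vec using (Vec; map)
open import Data.Product using (Σ; _×_; _,_; proj₂)
open import Data.Sum using (_⊎_)
open import Data.Empty using (⊥)
open import Data.List using (List)
open import Data.List.Membership.Propositional using (_∈_)
open import Relation.Binary.PropositionalEquality using (_≡_)
open import Relation.Nullary using (¬_)
open import Function using (_∘_; _⇔_)

-- Relational vocabulary: a symbol is (name , arity).  Function and
-- constant symbols are regarded as predicate symbols.

Sym : Set
Sym = ℕ × ℕ

arity : Sym → ℕ
arity = proj₂

Vocab : Set₁
Vocab = Sym → Set

-- First-order formulas with equality; n = number of free variables
-- (de Bruijn indices).

data Formula (n : ℕ) : Set where
  rel  : (s : Sym) → Vec (Fin n) (arity s) → Formula n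
  eq   : Fin n → Fin n → Formula n
  ⊥'   : Formula n
  ¬'_  : Formula n → Formula n
  _∧'_ : Formula n → Formula n → Formula n
  _∨'_ : Formula n → Formula n → Formula n
  _⇒'_ : Formula n → Formula n → Formula n
  ∀'   : Formula (suc n) → Formula n
  ∃'   : Formula (suc n) → Formula n

Sentence : Set
Sentence = Formula 0

Occurs : ∀ {n} → Sym → Formula n → Set
Occurs s (rel s' _) = s ≡ s'
Occurs s (eq _ _)   = ⊥
Occurs s ⊥'         = ⊥
Occurs s (¬' φ)     = Occurs s φ
Occurs s (φ ∧' ψ)   = Occurs s φ ⊎ Occurs s ψ
Occurs s (φ ∨' ψ)   = Occurs s φ ⊎ Occurs s ψ
Occurs s (φ ⇒' ψ)   = Occurs s φ ⊎ Occurs s ψ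
Occurs s (∀' φ)     = Occurs s φ
Occurs s (∃' φ)     = Occurs s φ

IsFormulaOver : ∀ {n} → Vocab → Formula n → Set
IsFormulaOver K φ = ∀ s → Occurs s φ → K s

SentenceSet : Set₁
SentenceSet = Sentence → Set

L : SentenceSet → Vocab
L Σ' s = Σ Sentence λ φ → Σ' φ × Occurs s φ

_∪⟨_⟩ : SentenceSet → Sentence → SentenceSet
(Γ ∪⟨ φ ⟩) ψ = Γ ψ ⊎ ψ ≡ φ

listSet : List Sentence → SentenceSet
listSet Γ₀ ψ = ψ ∈ Γ₀

-- Structures.  A structure interprets every symbol; a "K-structure" is
-- represented by a structure of which only the symbols in K are used.

Interp : Set → Set₁
Interp D = (s : Sym) → Vec D (arity s) → Set

record Structure : Set₁ where
  constructor mkStructure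
  field
    Dom : Set
    I   : Interp Dom
open Structure public

extend : ∀ {n} {D : Set} → (Fin n → D) → D → Fin (suc n) → D
extend ρ d zero    = d
extend ρ d (suc i) = ρ i

Sat : ∀ {n} (𝔄 : Structure) → Formula n → (Fin n → Dom 𝔄) → Set
Sat 𝔄 (rel s ts) ρ = I 𝔄 s (map ρ ts)
Sat 𝔄 (eq i j)   ρ = ρ i ≡ ρ j
Sat 𝔄 ⊥'         ρ = ⊥
Sat 𝔄 (¬' φ)     ρ = ¬ Sat 𝔄 φ ρ
Sat 𝔄 (φ ∧' ψ)   ρ = Sat 𝔄 φ ρ × Sat 𝔄 ψ ρ
Sat 𝔄 (φ ∨' ψ)   ρ = Sat 𝔄 φ ρ ⊎ Sat 𝔄 ψ ρ
Sat 𝔄 (φ ⇒' ψ)   ρ = Sat 𝔄 φ ρ → Sat 𝔄 ψ ρ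
Sat 𝔄 (∀' φ)     ρ = (d : Dom 𝔄) → Sat 𝔄 φ (extend ρ d)
Sat 𝔄 (∃' φ)     ρ = Σ (Dom 𝔄) λ d → Sat 𝔄 φ (extend ρ d)

_⊨_ : Structure → Sentence → Set
𝔄 ⊨ φ = Sat 𝔄 φ (λ ())

_⊨Set_ : Structure → SentenceSet → Set
𝔄 ⊨Set Γ = ∀ φ → Γ φ → 𝔄 ⊨ φ

_≺[_]_ : Structure → Vocab → Structure → Set
𝔄 ≺[ K ] 𝔅 = Σ (Dom 𝔄 → Dom 𝔅) λ f →
  ∀ n (ψ : Formula n) → IsFormulaOver K ψ →
  ∀ (ρ : Fin n → Dom 𝔄) → Sat 𝔄 ψ ρ ⇔ Sat 𝔅 ψ (f ∘ ρ)

-- 𝔄'' is an expansion of 𝔄 w.r.t. K: same domain, same interpretation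
-- of the symbols in K (given by an interpretation on Dom 𝔄).
AgreesOn : (𝔄 : Structure) → Vocab → Interp (Dom 𝔄) → Set
AgreesOn 𝔄 K J = ∀ s → K s → ∀ xs → J s xs ⇔ I 𝔄 s xs

_|∼_ : SentenceSet → Sentence → Set₁
Γ |∼ φ =
  ∀ (𝔄 : Structure) → 𝔄 ⊨Set Γ →
  Σ Structure λ 𝔄' → (𝔄 ≺[ L Γ ] 𝔄') ×
    Σ (Interp (Dom 𝔄')) λ J →
      AgreesOn 𝔄' (L Γ) J × (mkStructure (Dom 𝔄') J ⊨ φ)

{-# OPTIONS --safe #-}
-- Γ says that the unary predicates C₀, C₁, … are nonempty and pairwise disjoint,
-- so every model of Γ is infinite, and φ, which speaks only about fresh symbols
-- P and R, says that R restricted to P is an injective successor map with a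
-- starting point outside its range; an infinite domain can always interpret
-- P and R this way, so Γ |∼ φ without even extending the model. A finite
-- Γ₀ ⊆ Γ mentions finitely many Cᵢ and so has a finite model of some size m.
-- The sentence "every element equals one of x₀, …, x_{m-1}" has no non-logical
-- symbols, so it transfers along any elementary embedding, which is therefore
-- onto; thus no elementary extension can carry the infinite structure φ asks for.
module Submission where

open import Defs
open import Data.Nat using (ℕ; zero; suc; _≤_; _<_; _⊔_)
open import Data.Nat.Properties using (_≟_; ≤-trans; m≤m⊔n; m≤n⊔m; suc-injective; n<1+n)
open import Data.Fin using (Fin; zero; suc; toℕ; fromℕ<)
open import Data.Fin.Properties using (toℕ-fromℕ<; ℕ→Fin-notInjective)
open import Data.Vec using ([]; _∷_)
open import Data.Product using (Σ; ∃; _×_; _,_; proj₁; proj₂)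
open import Data.Sum using (_⊎_; inj₁; inj₂)
open import Data.Empty using (⊥; ⊥-elim)
open import Data.List using (List; []; _∷_)
open import Data.List.Membership.Propositional using (_∈_)
open import Data.List.Relation.Unary.Any using (here; there)
open import Relation.Nullary using (¬_; yes; no)
open import Relation.Binary.PropositionalEquality using (_≡_; _≢_; refl; sym; trans; cong; subst)
open import Function using (_∘_; id; mk⇔; Equivalence; Injective)

Inj : {A B : Set} → (A → B) → Set
Inj = Injective _≡_ _≡_

no-ℕ-injection-into-Fin-image : ∀ {m} {D : Set} (f : Fin m → D) → (∀ y → ∃ λ x → y ≡ f x) →
  (c : ℕ → D) → ¬ Inj c
no-ℕ-injection-into-Fin-image f onto c c-inj = ℕ→Fin-notInjective h h-inj
  where
  h : ℕ → Fin _
  h n = proj₁ (onto (c n))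

  h-inj : Inj h
  h-inj {n} {n′} e = c-inj (trans (proj₂ (onto (c n))) (trans (cong f e) (sym (proj₂ (onto (c n′))))))

bounded-stage : {A : Set} (S : ℕ → A → Set) → (∀ {m n x} → m ≤ n → S m x → S n x) →
  (xs : List A) → (∀ x → x ∈ xs → ∃ λ n → S n x) → ∃ λ n → ∀ x → x ∈ xs → S n x
bounded-stage S mono [] _ = 0 , λ _ ()
bounded-stage S mono (x ∷ xs) staged
  with n , Sx ← staged x (here refl)
     | N , Sxs ← bounded-stage S mono xs (λ y y∈xs → staged y (there y∈xs)) =
  n ⊔ N , λ { _ (here refl) → mono (m≤m⊔n n N) Sx
            ; y (there y∈xs) → mono (m≤n⊔m n N) (Sxs y y∈xs) }

injective-chain : {D : Set} (P : D → Set) (R : D → D → Set) (z : D) → P z → (∀ x → ¬ R x z) →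
  (∀ x → P x → ∃ λ y → P y × R x y) → (∀ {a b d} → R a d → R b d → a ≡ b) →
  Σ (ℕ → D) Inj
injective-chain {D} P R z Pz no-pred step R-inj = proj₁ ∘ chain , chain-inj
  where
  chain : ℕ → Σ D P
  chain zero    = z , Pz
  chain (suc n) = let (y , Py , _) = step (proj₁ (chain n)) (proj₂ (chain n)) in y , Py

  chain-R : ∀ n → R (proj₁ (chain n)) (proj₁ (chain (suc n)))
  chain-R n = proj₂ (proj₂ (step (proj₁ (chain n)) (proj₂ (chain n))))

  chain-inj : Inj (proj₁ ∘ chain)
  chain-inj {zero}  {zero}  _ = refl
  chain-inj {zero}  {suc n} e = ⊥-elim (no-pred _ (subst (R _) (sym e) (chain-R n)))
  chain-inj {suc m} {zero}  e = ⊥-elim (no-pred _ (subst (R _) e (chain-R m)))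
  chain-inj {suc m} {suc n} e = cong suc (chain-inj (R-inj (subst (R _) e (chain-R m)) (chain-R n)))

isOneOf : ∀ {n} k → (Fin k → Fin n) → Formula (suc n)
isOneOf zero    g = ⊥'
isOneOf (suc k) g = eq zero (suc (g zero)) ∨' isOneOf k (g ∘ suc)

isOneOf-symbolFree : ∀ {n} k (g : Fin k → Fin n) → IsFormulaOver (λ _ → ⊥) (isOneOf k g)
isOneOf-symbolFree zero    g s ()
isOneOf-symbolFree (suc k) g s (inj₁ ())
isOneOf-symbolFree (suc k) g s (inj₂ o) = isOneOf-symbolFree k (g ∘ suc) s o

Sat-isOneOf⁺ : ∀ {n} 𝔅 k (g : Fin k → Fin n) ρ d i → d ≡ ρ (g i) → Sat 𝔅 (isOneOf k g) (extend ρ d)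
Sat-isOneOf⁺ 𝔅 (suc k) g ρ d zero    e = inj₁ e
Sat-isOneOf⁺ 𝔅 (suc k) g ρ d (suc i) e = inj₂ (Sat-isOneOf⁺ 𝔅 k (g ∘ suc) ρ d i e)

Sat-isOneOf⁻ : ∀ {n} 𝔅 k (g : Fin k → Fin n) ρ d → Sat 𝔅 (isOneOf k g) (extend ρ d) →
  ∃ λ i → d ≡ ρ (g i)
Sat-isOneOf⁻ 𝔅 (suc k) g ρ d (inj₁ e) = zero , e
Sat-isOneOf⁻ 𝔅 (suc k) g ρ d (inj₂ s) with i , e ← Sat-isOneOf⁻ 𝔅 k (g ∘ suc) ρ d s = suc i , e

≺-from-Fin-onto : ∀ {m K} {I : Interp (Fin m)} {𝔅} → ((f , _) : mkStructure (Fin m) I ≺[ K ] 𝔅) →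
  ∀ y → ∃ λ x → y ≡ f x
≺-from-Fin-onto {m} {I = I} {𝔅} (f , elementary) y = Sat-isOneOf⁻ 𝔅 m id f y (𝔅-enumerated y)
  where
  enumerated : Formula m
  enumerated = ∀' (isOneOf m id)

  𝔅-enumerated : Sat 𝔅 enumerated f
  𝔅-enumerated = Equivalence.to
    (elementary m enumerated (λ s o → ⊥-elim (isOneOf-symbolFree m id s o)) id)
    (λ x → Sat-isOneOf⁺ (mkStructure (Fin m) I) m id id x x refl)

≺-refl : ∀ {𝔄 K} → 𝔄 ≺[ K ] 𝔄
≺-refl = id , λ _ _ _ _ → mk⇔ id id

C : ℕ → Sym
C i = suc (suc i) , 1

Psym Rsym : Sym
Psym = 0 , 1
Rsym = 1 , 2

inhabited : ℕ → Sentence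
inhabited i = ∃' (rel (C i) (zero ∷ []))

disjoint : ℕ → ℕ → Sentence
disjoint i j = ∀' (¬' (rel (C i) (zero ∷ []) ∧' rel (C j) (zero ∷ [])))

Γ : SentenceSet
Γ ψ = (∃ λ i → ψ ≡ inhabited i) ⊎ (∃ λ i → ∃ λ j → i ≢ j × ψ ≡ disjoint i j)

φ : Sentence
φ = ∃' (rel Psym (zero ∷ []) ∧' ∀' (¬' rel Rsym (zero ∷ suc zero ∷ [])))
  ∧' ( ∀' (rel Psym (zero ∷ []) ⇒' ∃' (rel Psym (zero ∷ []) ∧' rel Rsym (suc zero ∷ zero ∷ [])))
     ∧' ∀' (∀' (∀' ((rel Rsym (suc (suc zero) ∷ zero ∷ []) ∧' rel Rsym (suc zero ∷ zero ∷ []))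
                    ⇒' eq (suc (suc zero)) (suc zero)))))

⊨φ⇒ℕ-injection : ∀ 𝔅 → 𝔅 ⊨ φ → Σ (ℕ → Dom 𝔅) Inj
⊨φ⇒ℕ-injection 𝔅 ((z , Pz , no-pred) , step , R-inj) =
  injective-chain (λ x → I 𝔅 Psym (x ∷ [])) (λ x y → I 𝔅 Rsym (x ∷ y ∷ []))
    z Pz no-pred step (λ {a} {b} {d} Rad Rbd → R-inj a b d (Rad , Rbd))

withSuccessor : {D : Set} → (ℕ → D) → Interp D → Interp D
withSuccessor c J (0 , 1) (x ∷ [])     = ∃ λ i → x ≡ c i
withSuccessor c J (1 , 2) (x ∷ y ∷ []) = ∃ λ i → x ≡ c i × y ≡ c (suc i)
withSuccessor c J s xs                 = J s xs

withSuccessor-⊨φ : {D : Set} (c : ℕ → D) → Inj c → ∀ J → mkStructure D (withSuccessor c J) ⊨ φ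
withSuccessor-⊨φ c c-inj J =
    (c 0 , (0 , refl) , λ { _ (i , _ , c0≡csi) → 0≢1+n (c-inj c0≡csi) })
  , (λ { _ (i , refl) → c (suc i) , (suc i , refl) , (i , refl , refl) })
  , λ { a b _ ((i , refl , refl) , (j , refl , csi≡csj)) → cong c (suc-injective (c-inj csi≡csj)) }
  where
  0≢1+n : ∀ {n} → 0 ≢ suc n
  0≢1+n ()

L-Γ⇒C : ∀ {s} → L Γ s → ∃ λ i → s ≡ C i
L-Γ⇒C (_ , inj₁ (i , refl) , refl)             = i , refl
L-Γ⇒C (_ , inj₂ (i , j , _ , refl) , inj₁ refl) = i , refl
L-Γ⇒C (_ , inj₂ (i , j , _ , refl) , inj₂ refl) = j , refl

-- On a symbol Cᵢ = (2 + i , 1) withSuccessor falls through to its last clause.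
withSuccessor-agrees : ∀ 𝔄 (c : ℕ → Dom 𝔄) → AgreesOn 𝔄 (L Γ) (withSuccessor c (I 𝔄))
withSuccessor-agrees 𝔄 c s s∈LΓ xs with L-Γ⇒C s∈LΓ
... | i , refl = mk⇔ id id

⊨Γ⇒ℕ-injection : ∀ 𝔄 → 𝔄 ⊨Set Γ → Σ (ℕ → Dom 𝔄) Inj
⊨Γ⇒ℕ-injection 𝔄 ⊨Γ = witness , witness-inj
  where
  witness : ℕ → Dom 𝔄
  witness i = proj₁ (⊨Γ (inhabited i) (inj₁ (i , refl)))

  witness-C : ∀ i → I 𝔄 (C i) (witness i ∷ [])
  witness-C i = proj₂ (⊨Γ (inhabited i) (inj₁ (i , refl)))

  witness-inj : Inj witness
  witness-inj {i} {j} e with i ≟ j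
  ... | yes i≡j = i≡j
  ... | no  i≢j = ⊥-elim (⊨Γ (disjoint i j) (inj₂ (i , j , i≢j , refl)) (witness j)
                           (subst (λ x → I 𝔄 (C i) (x ∷ [])) e (witness-C i) , witness-C j))

Γ|∼φ : Γ |∼ φ
Γ|∼φ 𝔄 ⊨Γ with c , c-inj ← ⊨Γ⇒ℕ-injection 𝔄 ⊨Γ =
  𝔄 , ≺-refl , withSuccessor c (I 𝔄) , withSuccessor-agrees 𝔄 c , withSuccessor-⊨φ c c-inj (I 𝔄)

Γ-below : ℕ → SentenceSet
Γ-below n ψ = (∃ λ i → i < n × ψ ≡ inhabited i) ⊎ (∃ λ i → ∃ λ j → i ≢ j × ψ ≡ disjoint i j)

Γ-below-mono : ∀ {m n ψ} → m ≤ n → Γ-below m ψ → Γ-below n ψ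
Γ-below-mono m≤n (inj₁ (i , i<m , e)) = inj₁ (i , ≤-trans i<m m≤n , e)
Γ-below-mono m≤n (inj₂ d)             = inj₂ d

Γ⊆⋃Γ-below : ∀ {ψ} → Γ ψ → ∃ λ n → Γ-below n ψ
Γ⊆⋃Γ-below (inj₁ (i , e)) = suc i , inj₁ (i , n<1+n i , e)
Γ⊆⋃Γ-below (inj₂ d)       = 0 , inj₂ d

finiteModel : ℕ → Structure
finiteModel n = mkStructure (Fin n) C-singletons
  where
  C-singletons : Interp (Fin n)
  C-singletons (suc (suc i) , 1) (x ∷ []) = toℕ x ≡ i
  C-singletons _ _                        = ⊥

finiteModel-⊨Γ-below : ∀ n → finiteModel n ⊨Set Γ-below n
finiteModel-⊨Γ-below n _ (inj₁ (i , i<n , refl))    = fromℕ< i<n , toℕ-fromℕ< i<n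
finiteModel-⊨Γ-below n _ (inj₂ (i , j , i≢j , refl)) = λ x (x≡i , x≡j) → i≢j (trans (sym x≡i) x≡j)

finite-⊆Γ-not-|∼φ : (Γ₀ : List Sentence) → (∀ ψ → listSet Γ₀ ψ → Γ ψ) → ¬ (listSet Γ₀ |∼ φ)
finite-⊆Γ-not-|∼φ Γ₀ Γ₀⊆Γ Γ₀|∼φ
  with n , Γ₀⊆Γ-below ← bounded-stage Γ-below Γ-below-mono Γ₀ (λ ψ ψ∈Γ₀ → Γ⊆⋃Γ-below (Γ₀⊆Γ ψ ψ∈Γ₀))
  with 𝔅 , emb , J , _ , ⊨φ ← Γ₀|∼φ (finiteModel n) (λ ψ ψ∈Γ₀ → finiteModel-⊨Γ-below n ψ (Γ₀⊆Γ-below ψ ψ∈Γ₀))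
  with c , c-inj ← ⊨φ⇒ℕ-injection (mkStructure (Dom 𝔅) J) ⊨φ =
  no-ℕ-injection-into-Fin-image (proj₁ emb) (≺-from-Fin-onto emb) c c-inj

proposition7 : Σ SentenceSet λ Γ → Σ Sentence λ φ →
    (Γ |∼ φ) ×
    ((Γ₀ : List Sentence) → (∀ ψ → listSet Γ₀ ψ → Γ ψ) → ¬ (listSet Γ₀ |∼ φ))
proposition7 = Γ , φ , Γ|∼φ , finite-⊆Γ-not-|∼φ
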